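{- Let $k=o(\sqrt n)$ (with $n$ sufficiently large), let $x\in X$ and $y\in Y_x$, and let $S(x,y)=x\circ y\circ x\circ x$. If $\mathrm{HAM}(x,y)=\frac{k}{2}$, then the smallest $k$-period of $S(x,y)$ is $\frac{n}{4}$. On the other hand, if $\mathrm{HAM}(x,y)=\frac{k}{2}+1$, then the smallest $k$-period of $S(x,y)$ is greater than $\frac{n}{4}$.
   Context: Let $n$ be divisible by $4$ and $k$ even. Consider the infinite binary string $1^1 0^1 1^2 0^2 1^3 0^3\cdots$ (where $c^j$ denotes $j$ copies of $c$) and let $\nu$ be its prefix of length $\frac n4$. For strings $A,B$ of equal length, $\mathrm{HAM}(A,B)=|\{i:A[i]\neq B[i]\}|$. $X$ is the set of binary strings of length $\frac n4$ with $\mathrm{HAM}(x,\nu)=\frac k2$; for $x\in X$, $Y_x$ is the set of binary strings $y$ of length $\frac n4$ with $\mathrm{HAM}(x,y)\in\{\frac k2,\frac k2+1\}$. $\circ$ denotes concatenation. For a string $S$ of length $n$, $S[i,j]=S[i]\cdots S[j]$, and an integer $1\le p<n$ is a $k$-period of $S$ if $\mathrm{HAM}(S[1,n-p],S[p+1,n])\le k$. -}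

module Defs where

open import Data.Bool using (Bool; true; false; _xor_; if_then_else_)
open import Data.List using (List; []; _∷_; _++_; replicate; take; drop; length)
open import Data.Nat using (ℕ; zero; suc; _+_; _*_; _∸_; _≤_; _<_)
open import Data.Nat.DivMod using (_/_)
open import Data.Product using (_×_; ∃)
open import Data.Sum using (_⊎_)
open import Relation.Binary.PropositionalEquality using (_≡_)

-- Hamming distance of two binary strings (used only for equal lengths).
HAM : List Bool → List Bool → ℕ
HAM (a ∷ as) (b ∷ bs) = (if a xor b then 1 else 0) + HAM as bs
HAM _ _ = 0

blocks : ℕ → List Bool
blocks zero = []
blocks (suc j) = blocks j ++ (replicate (suc j) true ++ replicate (suc j) false)

-- ν of length m: prefix of length m of 1^1 0^1 1^2 0^2 ...
-- (blocks m has length m(m+1) ≥ m, so this is the length-m prefix)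
ν : ℕ → List Bool
ν m = take m (blocks m)

-- x ∈ X (for string length m = n/4 and parameter k)
InX : ℕ → ℕ → List Bool → Set
InX m k x = (length x ≡ m) × (HAM x (ν m) ≡ k / 2)

InY : ℕ → ℕ → List Bool → List Bool → Set
InY m k x y = (length y ≡ m) × ((HAM x y ≡ k / 2) ⊎ (HAM x y ≡ k / 2 + 1))

S : List Bool → List Bool → List Bool
S x y = x ++ (y ++ (x ++ x))

IsKPeriod : ℕ → List Bool → ℕ → Set
IsKPeriod k T p = (1 ≤ p) × (p < length T) × (HAM (take (length T ∸ p) T) (drop p T) ≤ k)

IsSmallestKPeriod : ℕ → List Bool → ℕ → Set
IsSmallestKPeriod k T p = IsKPeriod k T p × (∀ q → IsKPeriod k T q → p ≤ q)

LittleOSqrt : (ℕ → ℕ) → Set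
LittleOSqrt k = ∀ (c : ℕ) → ∃ λ N → ∀ n → N ≤ n → c * (k n * k n) ≤ n

module Submission where

-- Write m = n/4 and h = k/2, and let ν⁴ = S (ν m) (ν m). Every shift 0 < p < m of ν⁴ has at least
-- 12h + 3 mismatches. If p or m - p is below J ≈ √m, the shift contains a shift of ν by that amount,
-- and inside the prefix 1 0 1² 0² ⋯ 1^J 0^J of ν a shift by p costs p mismatches in every block
-- beyond the p-th. Otherwise compare the prefix of ν of length |blocks u| (u ≈ √(24h)) with a window
-- of ν at distance ≥ m/2 from the start: there all runs are longer than the window, so the window
-- switches value at most once, and such a string differs from 1 0 1² 0² ⋯ 1^u 0^u in at least
-- tri u - u positions. Since HAM(x, ν) = h and HAM(x, y) ≤ h + 1, S x y is within 5h + 1 of ν⁴,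
-- so all its shifts p < m still have more than 2h = k mismatches, while the shift by m has exactly
-- 2 HAM(x, y) of them.

open import Defs
open import Data.Bool using (Bool; true; false; not; _xor_; if_then_else_)
open import Data.Bool.Properties using (xor-comm; xor-same)
open import Data.List using (List; []; _∷_; _++_; replicate; take; drop; length)
open import Data.List.Properties
  using (++-assoc; length-++; length-replicate; ++-identityʳ; drop-drop; take-all; length-drop)
open import Data.Nat using (ℕ; zero; suc; _+_; _*_; _∸_; _⊔_; _≤_; _<_; z≤n; s≤s; s≤s⁻¹; z<s)
open import Data.Nat.Properties
open import Data.Nat.Tactic.RingSolver using (solve-∀)
open import Data.Nat.DivMod using (_/_; m/n*n≡m)
open import Data.Nat.Divisibility using (_∣_)
open import Data.Product using (_×_; _,_; ∃; proj₁; proj₂)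
open import Data.Sum using (_⊎_; inj₁; inj₂; [_,_]′)
open import Relation.Nullary using (Dec; yes; no; contradiction)
open import Relation.Binary.PropositionalEquality
  using (_≡_; _≢_; refl; sym; trans; cong; cong₂; subst; subst₂; module ≡-Reasoning)
open import Algebra.Properties.CommutativeSemigroup +-commutativeSemigroup
  using () renaming (interchange to +-interchange; xy∙z≈xz∙y to +-right-comm; x∙yz≈y∙xz to +-left-comm)

private
  variable
    X : Set

slice : ℕ → ℕ → List X → List X
slice i w xs = take w (drop i xs)

take-++ˡ : ∀ n (xs ys : List X) → n ≤ length xs → take n (xs ++ ys) ≡ take n xs
take-++ˡ zero    xs       ys _         = refl
take-++ˡ (suc n) (x ∷ xs) ys (s≤s n≤) = cong (x ∷_) (take-++ˡ n xs ys n≤)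

drop-++ˡ : ∀ n (xs ys : List X) → n ≤ length xs → drop n (xs ++ ys) ≡ drop n xs ++ ys
drop-++ˡ zero    xs       ys _         = refl
drop-++ˡ (suc n) (x ∷ xs) ys (s≤s n≤) = drop-++ˡ n xs ys n≤

take-length+ : ∀ (xs ys : List X) n → take (length xs + n) (xs ++ ys) ≡ xs ++ take n ys
take-length+ []       ys n = refl
take-length+ (x ∷ xs) ys n = cong (x ∷_) (take-length+ xs ys n)

drop-length+ : ∀ (xs ys : List X) n → drop (length xs + n) (xs ++ ys) ≡ drop n ys
drop-length+ []       ys n = refl
drop-length+ (x ∷ xs) ys n = drop-length+ xs ys n

drop-length : ∀ (xs ys : List X) → drop (length xs) (xs ++ ys) ≡ ys
drop-length []       ys = refl
drop-length (x ∷ xs) ys = drop-length xs ys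

drop-++ʳ : ∀ n (xs ys : List X) → length xs ≤ n → drop n (xs ++ ys) ≡ drop (n ∸ length xs) ys
drop-++ʳ n xs ys le = trans (cong (λ i → drop i (xs ++ ys)) (sym (m+[n∸m]≡n le))) (drop-length+ xs ys (n ∸ length xs))

take-+ : ∀ m n (xs : List X) → take (m + n) xs ≡ take m xs ++ take n (drop m xs)
take-+ zero    n xs       = refl
take-+ (suc m) n []       = sym (take-[] n)
  where
  take-[] : ∀ n → take {A = X} n [] ≡ []
  take-[] zero    = refl
  take-[] (suc n) = refl
take-+ (suc m) n (x ∷ xs) = cong (x ∷_) (take-+ m n xs)

length-take-≤ : ∀ n (xs : List X) → n ≤ length xs → length (take n xs) ≡ n
length-take-≤ zero    xs       _         = refl
length-take-≤ (suc n) (x ∷ xs) (s≤s n≤) = cong suc (length-take-≤ n xs n≤)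

slice-take : ∀ i w n (xs : List X) → i + w ≤ n → slice i w (take n xs) ≡ slice i w xs
slice-take zero    zero    n       xs       _          = refl
slice-take zero    (suc w) (suc n) []       _          = refl
slice-take zero    (suc w) (suc n) (x ∷ xs) (s≤s le) = cong (x ∷_) (slice-take zero w n xs le)
slice-take (suc i) w       (suc n) []       _          = refl
slice-take (suc i) w       (suc n) (x ∷ xs) (s≤s le) = slice-take i w n xs le

slice-++ˡ : ∀ i w (xs ys : List X) → i + w ≤ length xs → slice i w (xs ++ ys) ≡ slice i w xs
slice-++ˡ i w xs ys le = begin
  take w (drop i (xs ++ ys))   ≡⟨ cong (take w) (drop-++ˡ i xs ys (≤-trans (m≤m+n i w) le)) ⟩
  take w (drop i xs ++ ys)     ≡⟨ take-++ˡ w (drop i xs) ys w≤ ⟩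
  take w (drop i xs)           ∎
  where
  open ≡-Reasoning
  w≤ : w ≤ length (drop i xs)
  w≤ = subst (w ≤_) (sym (length-drop i xs)) (m+n≤o⇒m≤o∸n w (subst (_≤ length xs) (+-comm i w) le))

replicate-+ : ∀ m n (x : X) → replicate (m + n) x ≡ replicate m x ++ replicate n x
replicate-+ zero    n x = refl
replicate-+ (suc m) n x = cong (x ∷_) (replicate-+ m n x)

take-replicate : ∀ m n (x : X) → m ≤ n → take m (replicate n x) ≡ replicate m x
take-replicate zero    n       x _         = refl
take-replicate (suc m) (suc n) x (s≤s m≤) = cong (x ∷_) (take-replicate m n x m≤)

drop-replicate : ∀ m n (x : X) → drop m (replicate n x) ≡ replicate (n ∸ m) x
drop-replicate zero    n       x = refl
drop-replicate (suc m) zero    x = refl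
drop-replicate (suc m) (suc n) x = drop-replicate m n x

slice-replicate-++ : ∀ i w r Q (x y : X) → r ≤ i → (i ∸ r) + w ≤ Q →
                     slice i w (replicate r x ++ replicate Q y) ≡ replicate w y
slice-replicate-++ i w r Q x y r≤i fits = begin
  take w (drop i (replicate r x ++ replicate Q y))   ≡⟨ cong (take w) (drop-++ʳ i (replicate r x) _ r≤i') ⟩
  take w (drop (i ∸ length (replicate r x)) (replicate Q y))
                                                     ≡⟨ cong (λ j → take w (drop (i ∸ j) (replicate Q y))) (length-replicate r) ⟩
  take w (drop (i ∸ r) (replicate Q y))              ≡⟨ cong (take w) (drop-replicate (i ∸ r) Q y) ⟩
  take w (replicate (Q ∸ (i ∸ r)) y)                 ≡⟨ take-replicate w (Q ∸ (i ∸ r)) y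
                                                          (m+n≤o⇒m≤o∸n w (subst (_≤ Q) (+-comm (i ∸ r) w) fits)) ⟩
  replicate w y                                      ∎
  where
  open ≡-Reasoning
  r≤i' : length (replicate r x) ≤ i
  r≤i' = subst (_≤ i) (sym (length-replicate r)) r≤i

take-replicate-++ : ∀ m n (x : X) ys → m ≤ n → take m (replicate n x ++ ys) ≡ replicate m x
take-replicate-++ m n x ys m≤n =
  trans (take-++ˡ m (replicate n x) ys (subst (m ≤_) (sym (length-replicate n)) m≤n))
        (take-replicate m n x m≤n)

drop-replicate-++ : ∀ n (x : X) ys → drop n (replicate n x ++ ys) ≡ ys
drop-replicate-++ n x ys = subst (λ i → drop i (replicate n x ++ ys) ≡ ys) (length-replicate n)
                                 (drop-length (replicate n x) ys)

-- Hamming distance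

bitDist : Bool → Bool → ℕ
bitDist a b = if a xor b then 1 else 0

HAM-++ : ∀ (A B C D : List Bool) → length A ≡ length C →
         HAM (A ++ B) (C ++ D) ≡ HAM A C + HAM B D
HAM-++ []      B []      D _  = refl
HAM-++ (a ∷ A) B (c ∷ C) D eq =
  trans (cong (bitDist a c +_) (HAM-++ A B C D (suc-injective eq))) (sym (+-assoc (bitDist a c) (HAM A C) (HAM B D)))

HAM-comm : ∀ (A B : List Bool) → HAM A B ≡ HAM B A
HAM-comm []      []      = refl
HAM-comm []      (b ∷ B) = refl
HAM-comm (a ∷ A) []      = refl
HAM-comm (a ∷ A) (b ∷ B) = cong₂ (λ c h → (if c then 1 else 0) + h) (xor-comm a b) (HAM-comm A B)

HAM-self≡0 : ∀ (A : List Bool) → HAM A A ≡ 0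
HAM-self≡0 []      = refl
HAM-self≡0 (a ∷ A) = cong₂ (λ c h → (if c then 1 else 0) + h) (xor-same a) (HAM-self≡0 A)

HAM-triangle : ∀ (A B C : List Bool) → length A ≡ length B → length B ≡ length C →
               HAM A C ≤ HAM A B + HAM B C
HAM-triangle []      B       C       _  _  = z≤n
HAM-triangle (a ∷ A) (b ∷ B) (c ∷ C) e₁ e₂ = begin
  bitDist a c + HAM A C                        ≤⟨ +-mono-≤ (bitDist-triangle a b c)
                                                (HAM-triangle A B C (suc-injective e₁) (suc-injective e₂)) ⟩
  (bitDist a b + bitDist b c) + (HAM A B + HAM B C) ≡⟨ +-interchange (bitDist a b) (bitDist b c) (HAM A B) (HAM B C) ⟩
  (bitDist a b + HAM A B) + (bitDist b c + HAM B C) ∎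
  where
  open ≤-Reasoning
  bitDist-triangle : ∀ a b c → bitDist a c ≤ bitDist a b + bitDist b c
  bitDist-triangle true  true  c     = m≤n+m (bitDist true c) 0
  bitDist-triangle true  false true  = z≤n
  bitDist-triangle true  false false = s≤s z≤n
  bitDist-triangle false true  true  = s≤s z≤n
  bitDist-triangle false true  false = z≤n
  bitDist-triangle false false c     = ≤-refl

HAM-take+drop : ∀ i (A B : List Bool) → HAM A B ≡ HAM (take i A) (take i B) + HAM (drop i A) (drop i B)
HAM-take+drop zero    A       B       = refl
HAM-take+drop (suc i) []      B       = refl
HAM-take+drop (suc i) (a ∷ A) []      = sym (HAM-[]ʳ (drop i A))
  where
  HAM-[]ʳ : ∀ A → HAM A [] ≡ 0
  HAM-[]ʳ []      = refl
  HAM-[]ʳ (a ∷ A) = refl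
HAM-take+drop (suc i) (a ∷ A) (b ∷ B) =
  trans (cong (bitDist a b +_) (HAM-take+drop i A B))
        (sym (+-assoc (bitDist a b) (HAM (take i A) (take i B)) (HAM (drop i A) (drop i B))))

HAM-take-≤ : ∀ i (A B : List Bool) → HAM (take i A) (take i B) ≤ HAM A B
HAM-take-≤ i A B = subst (HAM (take i A) (take i B) ≤_) (sym (HAM-take+drop i A B)) (m≤m+n _ _)

HAM-drop-≤ : ∀ i (A B : List Bool) → HAM (drop i A) (drop i B) ≤ HAM A B
HAM-drop-≤ i A B = subst (HAM (drop i A) (drop i B) ≤_) (sym (HAM-take+drop i A B)) (m≤n+m _ _)

HAM-slice-≤ : ∀ i w (A B : List Bool) → HAM (slice i w A) (slice i w B) ≤ HAM A B
HAM-slice-≤ i w A B = ≤-trans (HAM-take-≤ w (drop i A) (drop i B)) (HAM-drop-≤ i A B)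

HAM-replicate-not : ∀ n a → HAM (replicate n a) (replicate n (not a)) ≡ n
HAM-replicate-not zero    a     = refl
HAM-replicate-not (suc n) true  = cong suc (HAM-replicate-not n true)
HAM-replicate-not (suc n) false = cong suc (HAM-replicate-not n false)

-- Mismatches of a shift

mismatches : List Bool → ℕ → ℕ
mismatches T p = HAM (take (length T ∸ p) T) (drop p T)

slice-HAM≤mismatches : ∀ T p a w → a + p + w ≤ length T →
                       HAM (slice a w T) (slice (a + p) w T) ≤ mismatches T p
slice-HAM≤mismatches T p a w le =
  subst₂ (λ U V → HAM U V ≤ mismatches T p) (slice-take a w (length T ∸ p) T a+w≤) shifted
         (HAM-slice-≤ a w (take (length T ∸ p) T) (drop p T))
  where
  a+w≤ : a + w ≤ length T ∸ p
  a+w≤ = m+n≤o⇒m≤o∸n (a + w) (subst (_≤ length T) (+-right-comm a p w) le)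
  shifted : slice a w (drop p T) ≡ slice (a + p) w T
  shifted = cong (take w) (trans (drop-drop p a T) (cong (λ i → drop i T) (+-comm p a)))

mismatches-++ : ∀ A C p → p ≤ length A →
                mismatches (A ++ C) p
                  ≡ mismatches A p + HAM (take (length C) (drop (length A ∸ p) (A ++ C))) C
mismatches-++ A C p p≤ = begin
  HAM (take (length (A ++ C) ∸ p) (A ++ C)) (drop p (A ++ C))
    ≡⟨ cong₂ HAM (trans (cong (λ i → take i (A ++ C)) length∸p) front) (drop-++ˡ p A C p≤) ⟩
  HAM (take q A ++ take (length C) (drop q (A ++ C))) (drop p A ++ C)
    ≡⟨ HAM-++ (take q A) _ (drop p A) C
              (trans (length-take-≤ q A (m∸n≤m (length A) p)) (sym (length-drop p A))) ⟩
  mismatches A p + HAM (take (length C) (drop q (A ++ C))) C ∎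
  where
  open ≡-Reasoning
  q : ℕ
  q = length A ∸ p
  length∸p : length (A ++ C) ∸ p ≡ q + length C
  length∸p = trans (cong (_∸ p) (length-++ A)) (+-∸-comm (length C) p≤)
  front : take (q + length C) (A ++ C) ≡ take q A ++ take (length C) (drop q (A ++ C))
  front = trans (take-+ q (length C) (A ++ C))
                (cong (_++ take (length C) (drop q (A ++ C))) (take-++ˡ q A C (m∸n≤m (length A) p)))

mismatches-++-≤ : ∀ A C p → mismatches A p ≤ mismatches (A ++ C) p
mismatches-++-≤ A C p with p ≤? length A
... | yes p≤ = subst (mismatches A p ≤_) (sym (mismatches-++ A C p p≤)) (m≤m+n _ _)
... | no  p≰ = subst (λ i → HAM (take i A) (drop p A) ≤ mismatches (A ++ C) p)
                     (sym (m≤n⇒m∸n≡0 (<⇒≤ (≰⇒> p≰)))) z≤n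

mismatches-perturb : ∀ T T' p → length T ≡ length T' →
                     mismatches T' p ≤ HAM T T' + (mismatches T p + HAM T T')
mismatches-perturb T T' p eq = begin
  mismatches T' p       ≡⟨ cong (λ n → HAM (take (n ∸ p) T') B') (sym eq) ⟩
  HAM A' B'             ≤⟨ HAM-triangle A' A B' (trans lA' (sym lA)) (trans lA (sym lB')) ⟩
  HAM A' A + HAM A B'   ≤⟨ +-mono-≤ (subst (_≤ HAM T T') (HAM-comm A A') (HAM-take-≤ L T T'))
                                    (HAM-triangle A B B' (trans lA (sym lB)) (trans lB (sym lB'))) ⟩
  HAM T T' + (HAM A B + HAM B B') ≤⟨ +-monoʳ-≤ (HAM T T') (+-monoʳ-≤ (HAM A B) (HAM-drop-≤ p T T')) ⟩
  HAM T T' + (mismatches T p + HAM T T') ∎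
  where
  open ≤-Reasoning
  L : ℕ
  L = length T ∸ p
  A : List Bool
  A = take L T
  A' : List Bool
  A' = take L T'
  B : List Bool
  B = drop p T
  B' : List Bool
  B' = drop p T'
  lA : length A ≡ L
  lA = length-take-≤ L T (m∸n≤m (length T) p)
  lA' : length A' ≡ L
  lA' = length-take-≤ L T' (subst (L ≤_) eq (m∸n≤m (length T) p))
  lB : length B ≡ L
  lB = length-drop p T
  lB' : length B' ≡ L
  lB' = trans (length-drop p T') (cong (_∸ p) (sym eq))

-- The string 1 0 1² 0² 1³ 0³ ⋯

tri : ℕ → ℕ
tri zero    = 0
tri (suc n) = suc n + tri n

block : ℕ → List Bool
block j = replicate j true ++ replicate j false

length-block : ∀ j → length (block j) ≡ j + j
length-block j = trans (length-++ (replicate j true)) (cong₂ _+_ (length-replicate j) (length-replicate j))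

length-blocks-suc : ∀ M → length (blocks (suc M)) ≡ length (blocks M) + (suc M + suc M)
length-blocks-suc M = trans (length-++ (blocks M)) (cong (length (blocks M) +_) (length-block (suc M)))

length-blocks : ∀ M → length (blocks M) ≡ tri M + tri M
length-blocks zero    = refl
length-blocks (suc M) = begin
  length (blocks (suc M))               ≡⟨ length-blocks-suc M ⟩
  length (blocks M) + (suc M + suc M)   ≡⟨ cong (_+ (suc M + suc M)) (length-blocks M) ⟩
  (tri M + tri M) + (suc M + suc M)     ≡⟨ +-interchange (tri M) (tri M) (suc M) (suc M) ⟩
  (tri M + suc M) + (tri M + suc M)     ≡⟨ cong₂ _+_ (+-comm (tri M) (suc M)) (+-comm (tri M) (suc M)) ⟩
  tri (suc M) + tri (suc M)             ∎
  where open ≡-Reasoning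

length-blocks-closed : ∀ M → length (blocks M) ≡ M * suc M
length-blocks-closed zero    = refl
length-blocks-closed (suc M) =
  trans (length-blocks-suc M) (trans (cong (_+ (suc M + suc M)) (length-blocks-closed M)) (closed M))
  where
  closed : ∀ M → M * suc M + (suc M + suc M) ≡ suc M * suc (suc M)
  closed = solve-∀

blocks-prefix : ∀ i j → i ≤ j → ∃ λ R → blocks j ≡ blocks i ++ R
blocks-prefix i j i≤j = subst (λ j → ∃ λ R → blocks j ≡ blocks i ++ R) (m+[n∸m]≡n i≤j) (extend (j ∸ i))
  where
  extend : ∀ d → ∃ λ R → blocks (i + d) ≡ blocks i ++ R
  extend zero = [] , trans (cong blocks (+-identityʳ i)) (sym (++-identityʳ (blocks i)))
  extend (suc d) with extend d
  ... | R , eq = R ++ block (suc (i + d)) ,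
    (begin
      blocks (i + suc d)                       ≡⟨ cong blocks (+-suc i d) ⟩
      blocks (i + d) ++ block (suc (i + d))    ≡⟨ cong (_++ block (suc (i + d))) eq ⟩
      (blocks i ++ R) ++ block (suc (i + d))   ≡⟨ ++-assoc (blocks i) R (block (suc (i + d))) ⟩
      blocks i ++ (R ++ block (suc (i + d)))   ∎)
    where open ≡-Reasoning

length-blocks-mono : ∀ i j → i ≤ j → length (blocks i) ≤ length (blocks j)
length-blocks-mono i j i≤j with blocks-prefix i j i≤j
... | R , eq = subst (length (blocks i) ≤_) (sym (trans (cong length eq) (length-++ (blocks i))))
                     (m≤m+n (length (blocks i)) (length R))

n≤length-blocks : ∀ n → n ≤ length (blocks n)
n≤length-blocks n = subst (n ≤_) (sym (length-blocks-closed n)) (m≤m*n n (suc n))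

length-blocks-double : ∀ w → length (blocks w) + length (blocks w) ≤ length (blocks (w + w))
length-blocks-double w = subst₂ _≤_ (sym (cong₂ _+_ (length-blocks-closed w) (length-blocks-closed w)))
                                    (sym (length-blocks-closed (w + w)))
                                    (subst (w * suc w + w * suc w ≤_) (sym (expand w)) (m≤m+n _ (w * w + w * w)))
  where
  expand : ∀ w → (w + w) * suc (w + w) ≡ (w * suc w + w * suc w) + (w * w + w * w)
  expand = solve-∀

slice-shifted-block : ∀ Z s → length Z ≤ s → slice s (length Z) (Z ++ block s) ≡ replicate (length Z) true
slice-shifted-block Z s p≤s = begin
  slice s p (Z ++ block s)                      ≡⟨ cong (λ i → slice i p (Z ++ block s)) (sym (m+[n∸m]≡n p≤s)) ⟩
  take p (drop (p + t) (Z ++ block s))          ≡⟨ cong (take p) (drop-length+ Z (block s) t) ⟩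
  take p (drop t (block s))                     ≡⟨ cong (take p) (drop-++ˡ t (replicate s true) (replicate s false)
                                                     (subst (t ≤_) (sym (length-replicate s)) (m∸n≤m s p))) ⟩
  take p (drop t (replicate s true) ++ replicate s false)
                                                ≡⟨ cong (λ R → take p (R ++ replicate s false)) (drop-replicate t s true) ⟩
  take p (replicate (s ∸ t) true ++ replicate s false)
                                                ≡⟨ take-replicate-++ p (s ∸ t) true (replicate s false)
                                                     (≤-reflexive (sym (m∸[m∸n]≡n p≤s))) ⟩
  replicate p true                              ∎
  where
  open ≡-Reasoning
  p : ℕ
  p = length Z
  t : ℕ
  t = s ∸ p

shifted-block-HAM : ∀ Z s → length Z ≤ s → length Z ≤ HAM (take (s + s) (Z ++ block s)) (block s)
shifted-block-HAM Z s p≤s = begin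
  p                                                 ≡⟨ sym (HAM-replicate-not p true) ⟩
  HAM (replicate p true) (replicate p false)        ≡⟨ sym (cong₂ HAM ones zeros) ⟩
  HAM (slice s p (take (s + s) (Z ++ block s))) (slice s p (block s))
                                                    ≤⟨ HAM-slice-≤ s p _ (block s) ⟩
  HAM (take (s + s) (Z ++ block s)) (block s)       ∎
  where
  open ≤-Reasoning
  p : ℕ
  p = length Z
  ones : slice s p (take (s + s) (Z ++ block s)) ≡ replicate p true
  ones = trans (slice-take s p (s + s) (Z ++ block s) (+-monoʳ-≤ s p≤s)) (slice-shifted-block Z s p≤s)
  zeros : slice s p (block s) ≡ replicate p false
  zeros = trans (cong (take p) (drop-replicate-++ s true (replicate s false))) (take-replicate p s false p≤s)

mismatches-blocks-suc : ∀ M p → p ≤ M → mismatches (blocks M) p + p ≤ mismatches (blocks (suc M)) p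
mismatches-blocks-suc M p p≤M = begin
  mismatches B p + p
    ≤⟨ +-monoʳ-≤ (mismatches B p) (subst (_≤ HAM (take (s + s) (drop q B ++ E)) E) length-tail
                                          (shifted-block-HAM (drop q B) s (subst (_≤ s) (sym length-tail) (m≤n⇒m≤1+n p≤M)))) ⟩
  mismatches B p + HAM (take (s + s) (drop q B ++ E)) E
    ≡⟨ sym (cong₂ (λ i Y → mismatches B p + HAM (take i Y) E) (length-block s) (drop-++ˡ q B E (m∸n≤m (length B) p))) ⟩
  mismatches B p + HAM (take (length E) (drop q (B ++ E))) E
    ≡⟨ sym (mismatches-++ B E p p≤B) ⟩
  mismatches (blocks (suc M)) p ∎
  where
  open ≤-Reasoning
  s : ℕ
  s = suc M
  B : List Bool
  B = blocks M
  E : List Bool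
  E = block s
  q : ℕ
  q = length B ∸ p
  p≤B : p ≤ length B
  p≤B = ≤-trans p≤M (n≤length-blocks M)
  length-tail : length (drop q B) ≡ p
  length-tail = trans (length-drop q B) (m∸[m∸n]≡n p≤B)

mismatches-blocks : ∀ d p → d * p ≤ mismatches (blocks (d + p)) p
mismatches-blocks zero    p = z≤n
mismatches-blocks (suc d) p = begin
  p + d * p                              ≡⟨ +-comm p (d * p) ⟩
  d * p + p                              ≤⟨ +-monoˡ-≤ p (mismatches-blocks d p) ⟩
  mismatches (blocks (d + p)) p + p      ≤⟨ mismatches-blocks-suc (d + p) p (m≤n+m p d) ⟩
  mismatches (blocks (suc d + p)) p      ∎
  where open ≤-Reasoning

HAM-block-const : ∀ j c → HAM (block j) (replicate (j + j) c) ≡ j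
HAM-block-const j c = trans (cong (HAM (block j)) (replicate-+ j j c))
                            (trans (HAM-++ (replicate j true) (replicate j false) (replicate j c) (replicate j c)
                                           (trans (length-replicate j) (sym (length-replicate j))))
                                   (halves c))
  where
  halves : ∀ c → HAM (replicate j true) (replicate j c) + HAM (replicate j false) (replicate j c) ≡ j
  halves true  = cong₂ _+_ (HAM-self≡0 (replicate j true)) (HAM-replicate-not j false)
  halves false = trans (cong₂ _+_ (HAM-replicate-not j true) (HAM-self≡0 (replicate j false))) (+-identityʳ j)

HAM-blocks-const : ∀ s c → HAM (blocks s) (replicate (length (blocks s)) c) ≡ tri s
HAM-blocks-const zero    c = refl
HAM-blocks-const (suc s) c = begin
  HAM (blocks s ++ block (suc s)) (replicate (length (blocks (suc s))) c)
    ≡⟨ cong (λ i → HAM (blocks s ++ block (suc s)) (replicate i c)) (length-blocks-suc s) ⟩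
  HAM (blocks s ++ block (suc s)) (replicate (length (blocks s) + (suc s + suc s)) c)
    ≡⟨ cong (HAM (blocks s ++ block (suc s))) (replicate-+ (length (blocks s)) (suc s + suc s) c) ⟩
  HAM (blocks s ++ block (suc s)) (replicate (length (blocks s)) c ++ replicate (suc s + suc s) c)
    ≡⟨ HAM-++ (blocks s) (block (suc s)) _ _ (sym (length-replicate (length (blocks s)))) ⟩
  HAM (blocks s) (replicate (length (blocks s)) c) + HAM (block (suc s)) (replicate (suc s + suc s) c)
    ≡⟨ cong₂ _+_ (HAM-blocks-const s c) (HAM-block-const (suc s) c) ⟩
  tri s + suc s
    ≡⟨ +-comm (tri s) (suc s) ⟩
  tri (suc s) ∎
  where open ≡-Reasoning

SingleSwitch : ℕ → List Bool → Set
SingleSwitch w W = ∃ λ c → ∃ λ r → ∃ λ Q → w ≤ Q × W ≡ take w (replicate r c ++ replicate Q (not c))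

HAM-blocks-suc : ∀ s V → length (blocks s) ≤ length V →
                 HAM (blocks (suc s)) (take (length (blocks (suc s))) V)
                   ≡ HAM (blocks s) (take (length (blocks s)) V)
                     + HAM (block (suc s)) (slice (length (blocks s)) (suc s + suc s) V)
HAM-blocks-suc s V w≤V = begin
  HAM (blocks (suc s)) (take (length (blocks (suc s))) V)
    ≡⟨ cong (λ i → HAM (blocks (suc s)) (take i V)) (length-blocks-suc s) ⟩
  HAM (blocks s ++ block (suc s)) (take (w + (suc s + suc s)) V)
    ≡⟨ cong (HAM (blocks s ++ block (suc s))) (take-+ w (suc s + suc s) V) ⟩
  HAM (blocks s ++ block (suc s)) (take w V ++ slice w (suc s + suc s) V)
    ≡⟨ HAM-++ (blocks s) (block (suc s)) (take w V) _ (sym (length-take-≤ w V w≤V)) ⟩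
  HAM (blocks s) (take w V) + HAM (block (suc s)) (slice w (suc s + suc s) V) ∎
  where
  open ≡-Reasoning
  w : ℕ
  w = length (blocks s)

HAM-blocks-switch : ∀ s c r Q → length (blocks s) ≤ Q →
                    tri s ≤ HAM (blocks s) (take (length (blocks s)) (replicate r c ++ replicate Q (not c))) + s
HAM-blocks-switch zero    c r Q _  = z≤n
HAM-blocks-switch (suc s) c r Q le = subst (λ H → suc s + tri s ≤ H + suc s) (sym split) (bound (w ≤? r))
  where
  open ≤-Reasoning
  w : ℕ
  w = length (blocks s)
  e : ℕ
  e = suc s + suc s
  V : List Bool
  V = replicate r c ++ replicate Q (not c)
  w+e≤Q : w + e ≤ Q
  w+e≤Q = subst (_≤ Q) (length-blocks-suc s) le
  H₁ : ℕ
  H₁ = HAM (blocks s) (take w V)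
  H₂ : ℕ
  H₂ = HAM (block (suc s)) (slice w e V)
  split : HAM (blocks (suc s)) (take (length (blocks (suc s))) V) ≡ H₁ + H₂
  split = HAM-blocks-suc s V (subst (w ≤_) (sym (length-++ (replicate r c)))
                                    (≤-trans (m+n≤o⇒m≤o w w+e≤Q) (≤-trans (m≤n+m Q r) (≤-reflexive
                                      (cong₂ _+_ (sym (length-replicate r)) (sym (length-replicate Q)))))))
  bound : Dec (w ≤ r) → suc s + tri s ≤ (H₁ + H₂) + suc s
  bound (yes w≤r) = begin
    suc s + tri s         ≡⟨ +-comm (suc s) (tri s) ⟩
    tri s + suc s         ≤⟨ +-monoˡ-≤ (suc s) (m≤m+n (tri s) H₂) ⟩
    (tri s + H₂) + suc s  ≡⟨ cong (λ h → (h + H₂) + suc s) (sym constant) ⟩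
    (H₁ + H₂) + suc s     ∎
    where
    constant : H₁ ≡ tri s
    constant = trans (cong (HAM (blocks s)) (take-replicate-++ w r c (replicate Q (not c)) w≤r)) (HAM-blocks-const s c)
  bound (no w≰r) = begin
    suc s + tri s         ≤⟨ +-monoʳ-≤ (suc s) (HAM-blocks-switch s c r Q (m+n≤o⇒m≤o w w+e≤Q)) ⟩
    suc s + (H₁ + s)      ≡⟨ rearrange (suc s) H₁ s ⟩
    (H₁ + suc s) + s      ≤⟨ +-monoʳ-≤ (H₁ + suc s) (n≤1+n s) ⟩
    (H₁ + suc s) + suc s  ≡⟨ cong (λ h → (H₁ + h) + suc s) (sym constant) ⟩
    (H₁ + H₂) + suc s     ∎
    where
    constant : H₂ ≡ suc s
    constant = trans (cong (HAM (block (suc s)))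
                           (slice-replicate-++ w e r Q c (not c) (<⇒≤ (≰⇒> w≰r))
                                               (≤-trans (+-monoˡ-≤ e (m∸n≤m w r)) w+e≤Q)))
                     (HAM-block-const (suc s) (not c))
    rearrange : ∀ a h b → a + (h + b) ≡ (h + a) + b
    rearrange = solve-∀

HAM-blocks-SingleSwitch : ∀ s W → SingleSwitch (length (blocks s)) W → tri s ≤ HAM (blocks s) W + s
HAM-blocks-SingleSwitch s W (c , r , Q , w≤Q , refl) = HAM-blocks-switch s c r Q w≤Q

-- Far windows of the string switch at most once

far-window-short : ∀ M b w → length (blocks w) ≤ b → b + w ≤ length (blocks M) → w ≤ M
far-window-short M b w far fits with w ≤? M
... | yes w≤M = w≤M
... | no  w≰M = contradiction (begin
  length (blocks (suc M))  ≤⟨ length-blocks-mono (suc M) w (≰⇒> w≰M) ⟩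
  length (blocks w)        ≤⟨ far ⟩
  b                        ≤⟨ m≤m+n b w ⟩
  b + w                    ≤⟨ fits ⟩
  length (blocks M)        ∎) (<⇒≱ (subst (length (blocks M) <_) (sym (length-blocks-suc M)) (m<m+n _ z<s)))
  where open ≤-Reasoning

blocks-suffix-false : ∀ M ℓ → ℓ ≤ M → drop (length (blocks M) ∸ ℓ) (blocks M) ≡ replicate ℓ false
blocks-suffix-false zero    zero    _    = refl
blocks-suffix-false (suc M) ℓ       ℓ≤s = begin
  drop (length (blocks (suc M)) ∸ ℓ) (blocks M ++ block s)
    ≡⟨ cong (λ i → drop i (blocks M ++ block s)) offset ⟩
  drop (length (blocks M) + (s + (s ∸ ℓ))) (blocks M ++ block s)
    ≡⟨ drop-length+ (blocks M) (block s) (s + (s ∸ ℓ)) ⟩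
  drop (s + (s ∸ ℓ)) (replicate s true ++ replicate s false)
    ≡⟨ cong (λ i → drop (i + (s ∸ ℓ)) (block s)) (sym (length-replicate s)) ⟩
  drop (length (replicate s true) + (s ∸ ℓ)) (replicate s true ++ replicate s false)
    ≡⟨ drop-length+ (replicate s true) (replicate s false) (s ∸ ℓ) ⟩
  drop (s ∸ ℓ) (replicate s false)
    ≡⟨ drop-replicate (s ∸ ℓ) s false ⟩
  replicate (s ∸ (s ∸ ℓ)) false
    ≡⟨ cong (λ i → replicate i false) (m∸[m∸n]≡n ℓ≤s) ⟩
  replicate ℓ false ∎
  where
  open ≡-Reasoning
  s : ℕ
  s = suc M
  offset : length (blocks s) ∸ ℓ ≡ length (blocks M) + (s + (s ∸ ℓ))
  offset = trans (cong (_∸ ℓ) (length-blocks-suc M))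
                 (trans (+-∸-assoc (length (blocks M)) (≤-trans ℓ≤s (m≤m+n s s)))
                        (cong (length (blocks M) +_) (+-∸-assoc s ℓ≤s)))

slice-block-SingleSwitch : ∀ s b w → w ≤ s → b + w ≤ s + s → SingleSwitch w (slice b w (block s))
slice-block-SingleSwitch s b w w≤s fits with b ≤? s
... | yes b≤s = true , s ∸ b , s , w≤s ,
  cong (take w) (trans (drop-++ˡ b (replicate s true) (replicate s false) (subst (b ≤_) (sym (length-replicate s)) b≤s))
                       (cong (_++ replicate s false) (drop-replicate b s true)))
... | no  b≰s = false , w , w , ≤-refl ,
  trans (slice-replicate-++ b w s s true false s≤b fits')
        (sym (take-replicate-++ w w false (replicate w true) ≤-refl))
  where
  s≤b : s ≤ b
  s≤b = <⇒≤ (≰⇒> b≰s)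
  fits' : (b ∸ s) + w ≤ s
  fits' = subst₂ _≤_ (+-∸-comm w s≤b) (m+n∸m≡n s s) (∸-monoˡ-≤ s fits)

slice-blocks-SingleSwitch : ∀ M b w → length (blocks w) ≤ b → b + w ≤ length (blocks M) →
                            SingleSwitch w (slice b w (blocks M))
slice-blocks-SingleSwitch M       b zero          _   _    = true , 0 , 0 , z≤n , refl
slice-blocks-SingleSwitch zero    b (suc w)       far fits = contradiction (far-window-short zero b (suc w) far fits) λ ()
slice-blocks-SingleSwitch (suc M) b w@(suc _)     far fits = cases (b + w ≤? length B) (b ≤? length B)
  where
  s : ℕ
  s = suc M
  B : List Bool
  B = blocks M
  E : List Bool
  E = block s
  w≤s : w ≤ s
  w≤s = far-window-short s b w far fits
  cases : Dec (b + w ≤ length B) → Dec (b ≤ length B) → SingleSwitch w (slice b w (B ++ E))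
  cases (yes inside) _ = subst (SingleSwitch w) (sym (slice-++ˡ b w B E inside))
                               (slice-blocks-SingleSwitch M b w far inside)
  cases (no outside) (yes b≤B) = false , ℓ , s , w≤s , (begin
    take w (drop b (B ++ E))                                   ≡⟨ cong (take w) (drop-++ˡ b B E b≤B) ⟩
    take w (drop b B ++ E)                                     ≡⟨ cong (λ Z → take w (Z ++ E)) zeros ⟩
    take w (replicate ℓ false ++ E)                            ≡⟨ cong (take w) (sym (++-assoc (replicate ℓ false) _ _)) ⟩
    take w ((replicate ℓ false ++ replicate s true) ++ replicate s false)
                                                               ≡⟨ take-++ˡ w _ (replicate s false) w≤ ⟩
    take w (replicate ℓ false ++ replicate s true)             ∎)
    where
    open ≡-Reasoning
    ℓ : ℕ
    ℓ = length B ∸ b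
    ℓ<w : ℓ < w
    ℓ<w = m<n+o⇒m∸n<o (length B) b (≰⇒> outside)
    zeros : drop b B ≡ replicate ℓ false
    zeros = trans (cong (λ i → drop i B) (sym (m∸[m∸n]≡n b≤B))) (blocks-suffix-false M ℓ (s≤s⁻¹ (≤-trans ℓ<w w≤s)))
    w≤ : w ≤ length (replicate ℓ false ++ replicate s true)
    w≤ = subst (w ≤_) (sym (trans (length-++ (replicate ℓ false)) (cong₂ _+_ (length-replicate ℓ) (length-replicate s))))
               (≤-trans w≤s (m≤n+m s ℓ))
  cases (no outside) (no b≰B) = subst (SingleSwitch w) (sym (cong (take w) beyond))
                                      (slice-block-SingleSwitch s b' w w≤s fits')
    where
    b' : ℕ
    b' = b ∸ length B
    B≤b : length B ≤ b
    B≤b = <⇒≤ (≰⇒> b≰B)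
    beyond : drop b (B ++ E) ≡ drop b' E
    beyond = drop-++ʳ b B E B≤b
    fits' : b' + w ≤ s + s
    fits' = subst₂ _≤_ (+-∸-comm w B≤b) (m+n∸m≡n (length B) (s + s))
                   (∸-monoˡ-≤ (length B) (subst (b + w ≤_) (length-blocks-suc M) fits))

m+m≤n+n⇒m≤n : ∀ m n → m + m ≤ n + n → m ≤ n
m+m≤n+n⇒m≤n m n le with m ≤? n
... | yes m≤n = m≤n
... | no  m≰n = contradiction le (<⇒≱ (+-mono-< (≰⇒> m≰n) (≰⇒> m≰n)))

m+m≤n⇒m≤[n∸p]*p : ∀ m n p → m + m ≤ n → 1 ≤ p → p < n → m ≤ (n ∸ p) * p
m+m≤n⇒m≤[n∸p]*p m n p m+m≤n 1≤p p<n with p ≤? m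
... | yes p≤m = begin
  m                ≤⟨ m+n≤o⇒m≤o∸n m (≤-trans (+-monoʳ-≤ m p≤m) m+m≤n) ⟩
  n ∸ p            ≡⟨ sym (*-identityʳ (n ∸ p)) ⟩
  (n ∸ p) * 1      ≤⟨ *-monoʳ-≤ (n ∸ p) 1≤p ⟩
  (n ∸ p) * p      ∎
  where open ≤-Reasoning
... | no  p≰m = begin
  m                ≤⟨ <⇒≤ (≰⇒> p≰m) ⟩
  p                ≡⟨ sym (*-identityˡ p) ⟩
  1 * p            ≤⟨ *-monoˡ-≤ p (m<n⇒0<n∸m p<n) ⟩
  (n ∸ p) * p      ∎
  where open ≤-Reasoning

-- ν and ν⁴

length-ν : ∀ m → length (ν m) ≡ m
length-ν m = length-take-≤ m (blocks m) (n≤length-blocks m)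

ν-prefix : ∀ m J → length (blocks J) ≤ m → ∃ λ R → ν m ≡ blocks J ++ R
ν-prefix m J J≤m with blocks-prefix J m (≤-trans (n≤length-blocks J) J≤m)
... | R , eq = take (m ∸ length (blocks J)) R , (begin
  take m (blocks m)                                       ≡⟨ cong (take m) eq ⟩
  take m (blocks J ++ R)                                  ≡⟨ cong (λ i → take i (blocks J ++ R)) (sym (m+[n∸m]≡n J≤m)) ⟩
  take (length (blocks J) + (m ∸ length (blocks J))) (blocks J ++ R)
                                                          ≡⟨ take-length+ (blocks J) R (m ∸ length (blocks J)) ⟩
  blocks J ++ take (m ∸ length (blocks J)) R              ∎)
  where open ≡-Reasoning

mismatches-ν-short-shift : ∀ m J K p → length (blocks J) ≤ m → K + K ≤ J → 1 ≤ p → p < J →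
                           K ≤ mismatches (ν m) p
mismatches-ν-short-shift m J K p J≤m K+K≤J 1≤p p<J with ν-prefix m J J≤m
... | R , eq = begin
  K                                      ≤⟨ m+m≤n⇒m≤[n∸p]*p K J p K+K≤J 1≤p p<J ⟩
  (J ∸ p) * p                            ≤⟨ mismatches-blocks (J ∸ p) p ⟩
  mismatches (blocks (J ∸ p + p)) p      ≡⟨ cong (λ i → mismatches (blocks i) p) (m∸n+n≡m (<⇒≤ p<J)) ⟩
  mismatches (blocks J) p                ≤⟨ mismatches-++-≤ (blocks J) R p ⟩
  mismatches (blocks J ++ R) p           ≡⟨ cong (λ T → mismatches T p) (sym eq) ⟩
  mismatches (ν m) p                     ∎
  where open ≤-Reasoning

far-slice-ν-HAM : ∀ m u b → length (blocks (length (blocks u))) ≤ b → b + length (blocks u) ≤ m →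
                  tri u ≤ HAM (take (length (blocks u)) (ν m)) (slice b (length (blocks u)) (ν m)) + u
far-slice-ν-HAM m u b far fits with ν-prefix m u (≤-trans (m≤n+m (length (blocks u)) b) fits)
... | R , eq = subst₂ (λ U V → tri u ≤ HAM U V + u) (sym head) (sym (slice-take b w m (blocks m) fits))
                      (HAM-blocks-SingleSwitch u _ (slice-blocks-SingleSwitch m b w far
                        (≤-trans fits (n≤length-blocks m))))
  where
  w : ℕ
  w = length (blocks u)
  head : take w (ν m) ≡ blocks u
  head = trans (cong (take w) eq) (trans (take-++ˡ w (blocks u) R ≤-refl) (take-all w (blocks u) ≤-refl))

mismatches-as-slice : ∀ A d p → d + p ≡ length A → mismatches A d ≡ HAM (slice d p A) (take p A)
mismatches-as-slice A d p d+p≡ = begin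
  HAM (take (length A ∸ d) A) (drop d A)   ≡⟨ cong (λ i → HAM (take i A) (drop d A)) A∸d≡p ⟩
  HAM (take p A) (drop d A)                ≡⟨ HAM-comm (take p A) (drop d A) ⟩
  HAM (drop d A) (take p A)                ≡⟨ cong (λ V → HAM V (take p A)) (sym (take-all p (drop d A) (≤-reflexive length-tail))) ⟩
  HAM (slice d p A) (take p A)             ∎
  where
  open ≡-Reasoning
  A∸d≡p : length A ∸ d ≡ p
  A∸d≡p = trans (cong (_∸ d) (sym d+p≡)) (m+n∸m≡n d p)
  length-tail : length (drop d A) ≡ p
  length-tail = trans (length-drop d A) A∸d≡p

slice-HAM≤mismatches-wrap : ∀ A R d p w → d + p ≡ length A → d + w ≤ length A →
                            HAM (slice d w A) (take w A) ≤ mismatches (A ++ (A ++ R)) p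
slice-HAM≤mismatches-wrap A R d p w d+p≡ d+w≤ =
  subst₂ (λ U V → HAM U V ≤ mismatches T p) (slice-++ˡ d w A (A ++ R) d+w≤) second-copy
         (slice-HAM≤mismatches T p d w fits)
  where
  T : List Bool
  T = A ++ (A ++ R)
  w≤A : w ≤ length A
  w≤A = ≤-trans (m≤n+m w d) d+w≤
  second-copy : slice (d + p) w T ≡ take w A
  second-copy = trans (cong (λ i → slice i w T) d+p≡)
                      (trans (cong (take w) (drop-length A (A ++ R))) (take-++ˡ w A R w≤A))
  fits : d + p + w ≤ length T
  fits = subst (_≤ length T) (cong (_+ w) (sym d+p≡))
               (subst (length A + w ≤_) (sym (length-++ A)) (+-monoʳ-≤ (length A)
                      (≤-trans w≤A (subst (length A ≤_) (sym (length-++ A)) (m≤m+n (length A) (length R))))))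

mismatches-ν⁴ : ∀ m u K p → K + u ≤ tri u → length (blocks (length (blocks u) + length (blocks u))) ≤ m →
                1 ≤ p → p < m → K ≤ mismatches (S (ν m) (ν m)) p
mismatches-ν⁴ m u K p K+u≤ J≤m 1≤p p<m = cases (p <? J) (d <? J) (m ≤? p + p)
  where
  w : ℕ
  w = length (blocks u)
  J : ℕ
  J = w + w
  A : List Bool
  A = ν m
  R : List Bool
  R = A ++ A
  d : ℕ
  d = m ∸ p
  d+p≡m : d + p ≡ m
  d+p≡m = m∸n+n≡m (<⇒≤ p<m)
  d+p≡A : d + p ≡ length A
  d+p≡A = trans d+p≡m (sym (length-ν m))
  K≤w : K ≤ w
  K≤w = ≤-trans (m+n≤o⇒m≤o K K+u≤) (subst (tri u ≤_) (sym (length-blocks u)) (m≤m+n (tri u) (tri u)))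
  far-HAM : ∀ b → m ≤ b + b → b + w ≤ m → K ≤ HAM (take w A) (slice b w A)
  far-HAM b m≤b+b fits = +-cancelʳ-≤ u K _ (≤-trans K+u≤ (far-slice-ν-HAM m u b far fits))
    where
    far : length (blocks w) ≤ b
    far = m+m≤n+n⇒m≤n _ b (≤-trans (length-blocks-double w) (≤-trans J≤m m≤b+b))
  cases : Dec (p < J) → Dec (d < J) → Dec (m ≤ p + p) → K ≤ mismatches (S A A) p
  cases (yes p<J) _ _ =
    ≤-trans (mismatches-ν-short-shift m J K p J≤m (+-mono-≤ K≤w K≤w) 1≤p p<J) (mismatches-++-≤ A (A ++ R) p)
  cases (no _) (yes d<J) _ = begin
    K                                ≤⟨ mismatches-ν-short-shift m J K d J≤m (+-mono-≤ K≤w K≤w) (m<n⇒0<n∸m p<m) d<J ⟩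
    mismatches A d                   ≡⟨ mismatches-as-slice A d p d+p≡A ⟩
    HAM (slice d p A) (take p A)     ≤⟨ slice-HAM≤mismatches-wrap A R d p p d+p≡A (≤-reflexive d+p≡A) ⟩
    mismatches (S A A) p             ∎
    where open ≤-Reasoning
  cases (no p≮J) (no d≮J) (yes m≤p+p) = begin
    K                                ≤⟨ far-HAM p m≤p+p p+w≤m ⟩
    HAM (take w A) (slice p w A)     ≤⟨ slice-HAM≤mismatches A p 0 w (subst (p + w ≤_) (sym (length-ν m)) p+w≤m) ⟩
    mismatches A p                   ≤⟨ mismatches-++-≤ A (A ++ R) p ⟩
    mismatches (S A A) p             ∎
    where
    open ≤-Reasoning
    p+w≤m : p + w ≤ m
    p+w≤m = subst (p + w ≤_) (trans (+-comm p d) d+p≡m) (+-monoʳ-≤ p (≤-trans (m≤m+n w w) (≮⇒≥ d≮J)))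
  cases (no p≮J) (no d≮J) (no m≰p+p) = begin
    K                                ≤⟨ far-HAM d m≤d+d d+w≤m ⟩
    HAM (take w A) (slice d w A)     ≡⟨ HAM-comm (take w A) (slice d w A) ⟩
    HAM (slice d w A) (take w A)     ≤⟨ slice-HAM≤mismatches-wrap A R d p w d+p≡A (subst (d + w ≤_) (sym (length-ν m)) d+w≤m) ⟩
    mismatches (S A A) p             ∎
    where
    open ≤-Reasoning
    d+w≤m : d + w ≤ m
    d+w≤m = subst (d + w ≤_) d+p≡m (+-monoʳ-≤ d (≤-trans (m≤m+n w w) (≮⇒≥ p≮J)))
    p≤d : p ≤ d
    p≤d = +-cancelˡ-≤ p p d (subst (p + p ≤_) (trans (sym d+p≡m) (+-comm d p)) (<⇒≤ (≰⇒> m≰p+p)))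
    m≤d+d : m ≤ d + d
    m≤d+d = subst (_≤ d + d) d+p≡m (+-monoʳ-≤ d p≤d)

length-S : ∀ x y → length (S x y) ≡ length x + (length y + (length x + length x))
length-S x y = trans (length-++ x) (cong (length x +_) (trans (length-++ y) (cong (length y +_) (length-++ x))))

HAM-S : ∀ x y x' y' → length x ≡ length x' → length y ≡ length y' →
        HAM (S x y) (S x' y') ≡ HAM x x' + (HAM y y' + (HAM x x' + HAM x x'))
HAM-S x y x' y' ex ey =
  trans (HAM-++ x (y ++ (x ++ x)) x' (y' ++ (x' ++ x')) ex)
        (cong (HAM x x' +_) (trans (HAM-++ y (x ++ x) y' (x' ++ x') ey) (cong (HAM y y' +_) (HAM-++ x x x' x' ex))))

mismatches-S-self : ∀ x y → length x ≡ length y → mismatches (S x y) (length x) ≡ HAM x y + HAM x y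
mismatches-S-self x y ex = begin
  HAM (take (length (S x y) ∸ length x) (S x y)) (drop (length x) (S x y))
    ≡⟨ cong₂ HAM (trans (cong (λ i → take i (S x y)) remaining) front) (drop-length x (y ++ (x ++ x))) ⟩
  HAM (x ++ (y ++ x)) (y ++ (x ++ x))
    ≡⟨ HAM-++ x (y ++ x) y (x ++ x) ex ⟩
  HAM x y + HAM (y ++ x) (x ++ x)
    ≡⟨ cong (HAM x y +_) (HAM-++ y x x x (sym ex)) ⟩
  HAM x y + (HAM y x + HAM x x)
    ≡⟨ cong (HAM x y +_) (trans (cong₂ _+_ (HAM-comm y x) (HAM-self≡0 x)) (+-identityʳ (HAM x y))) ⟩
  HAM x y + HAM x y ∎
  where
  open ≡-Reasoning
  remaining : length (S x y) ∸ length x ≡ length x + (length y + length x)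
  remaining = trans (cong (_∸ length x) (length-S x y))
                    (trans (m+n∸m≡n (length x) _) (+-left-comm (length y) (length x) (length x)))
  front : take (length x + (length y + length x)) (S x y) ≡ x ++ (y ++ x)
  front = trans (take-length+ x (y ++ (x ++ x)) _)
                (cong (x ++_) (trans (take-length+ y (x ++ x) (length x))
                                     (cong (y ++_) (trans (take-++ˡ (length x) x x ≤-refl) (take-all (length x) x ≤-refl)))))

short-shifts-S : ∀ m h u x y → 12 * h + 3 + u ≤ tri u → length (blocks (length (blocks u) + length (blocks u))) ≤ m →
                 length x ≡ m → length y ≡ m → HAM x (ν m) ≡ h → HAM x y ≤ h + 1 →
                 ∀ p → 1 ≤ p → p < m → h + h < mismatches (S x y) p
short-shifts-S m h u x y K+u≤ room |x| |y| x-ν x-y p 1≤p p<m =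
  +-cancelˡ-≤ (10 * h + 2) (suc (h + h)) M (subst₂ _≤_ (split h) (collect h M) (begin
    12 * h + 3                                  ≤⟨ mismatches-ν⁴ m u (12 * h + 3) p K+u≤ room 1≤p p<m ⟩
    mismatches (S (ν m) (ν m)) p                ≤⟨ mismatches-perturb (S x y) (S (ν m) (ν m)) p same-length ⟩
    D + (M + D)                                 ≤⟨ +-mono-≤ D≤ (+-monoʳ-≤ M D≤) ⟩
    (5 * h + 1) + (M + (5 * h + 1))             ∎))
  where
  open ≤-Reasoning
  M : ℕ
  M = mismatches (S x y) p
  D : ℕ
  D = HAM (S x y) (S (ν m) (ν m))
  |x|≡|ν| : length x ≡ length (ν m)
  |x|≡|ν| = trans |x| (sym (length-ν m))
  |y|≡|ν| : length y ≡ length (ν m)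
  |y|≡|ν| = trans |y| (sym (length-ν m))
  same-length : length (S x y) ≡ length (S (ν m) (ν m))
  same-length = trans (length-S x y) (trans (cong₂ (λ a b → a + (b + (a + a))) |x|≡|ν| |y|≡|ν|)
                                            (sym (length-S (ν m) (ν m))))
  y-ν : HAM y (ν m) ≤ (h + 1) + h
  y-ν = ≤-trans (HAM-triangle y x (ν m) (trans |y| (sym |x|)) |x|≡|ν|)
                (+-mono-≤ (subst (_≤ h + 1) (HAM-comm x y) x-y) (≤-reflexive x-ν))
  D≤ : D ≤ 5 * h + 1
  D≤ = begin
    D                                            ≡⟨ HAM-S x y (ν m) (ν m) |x|≡|ν| |y|≡|ν| ⟩
    HAM x (ν m) + (HAM y (ν m) + (HAM x (ν m) + HAM x (ν m)))
                                                 ≡⟨ cong (λ e → e + (HAM y (ν m) + (e + e))) x-ν ⟩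
    h + (HAM y (ν m) + (h + h))                  ≤⟨ +-monoʳ-≤ h (+-monoˡ-≤ (h + h) y-ν) ⟩
    h + ((h + 1) + h + (h + h))                  ≡⟨ total h ⟩
    5 * h + 1                                    ∎
    where
    total : ∀ h → h + ((h + 1) + h + (h + h)) ≡ 5 * h + 1
    total = solve-∀
  split : ∀ h → 12 * h + 3 ≡ (10 * h + 2) + suc (h + h)
  split = solve-∀
  collect : ∀ h M → (5 * h + 1) + (M + (5 * h + 1)) ≡ (10 * h + 2) + M
  collect = solve-∀

n≤tri : ∀ n → n ≤ tri n
n≤tri zero    = z≤n
n≤tri (suc n) = m≤m+n (suc n) (tri n)

tri-tight : ∀ u K → tri u ≤ K + u → u ≤ suc K
tri-tight zero    K _  = z≤n
tri-tight (suc u) K le = s≤s (≤-trans (n≤tri u) (+-cancelˡ-≤ (suc u) (tri u) K (subst (suc u + tri u ≤_) (+-comm K (suc u)) le)))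

tri-bracket : ∀ K → ∃ λ u → 1 ≤ u × K + u ≤ tri u × tri u ≤ 3 * K + 3
tri-bracket zero    = 1 , ≤-refl , ≤-refl , s≤s z≤n
tri-bracket (suc K) with tri-bracket K
... | u , 1≤u , K+u≤ , tri≤ with suc K + u ≤? tri u
...   | yes fits  = u , 1≤u , fits , ≤-trans tri≤ (+-monoˡ-≤ 3 (*-monoʳ-≤ 3 (n≤1+n K)))
...   | no  tight = suc u , s≤s z≤n , grow , bound
  where
  open ≤-Reasoning
  tri≤K+u : tri u ≤ K + u
  tri≤K+u = s≤s⁻¹ (≰⇒> tight)
  grow : suc K + suc u ≤ suc u + tri u
  grow = subst (_≤ suc u + tri u) (+-comm (suc u) (suc K))
               (+-monoʳ-≤ (suc u) (≤-trans (subst (_≤ K + u) (+-comm K 1) (+-monoʳ-≤ K 1≤u)) K+u≤))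
  bound : suc u + tri u ≤ 3 * suc K + 3
  bound = begin
    suc u + tri u                 ≤⟨ +-mono-≤ (s≤s u≤) (≤-trans tri≤K+u (+-monoʳ-≤ K u≤)) ⟩
    suc (suc K) + (K + suc K)     ≤⟨ slack K ⟩
    3 * suc K + 3                 ∎
    where
    u≤ : u ≤ suc K
    u≤ = tri-tight u K tri≤K+u
    slack : ∀ K → suc (suc K) + (K + suc K) ≤ 3 * suc K + 3
    slack K = subst (suc (suc K) + (K + suc K) ≤_) (expand K) (m≤m+n _ 3)
      where
      expand : ∀ K → suc (suc K) + (K + suc K) + 3 ≡ 3 * suc K + 3
      expand = solve-∀

sum-square-≤ : ∀ a b n → 4 * (a * a) ≤ n → 4 * (b * b) ≤ n → (a + b) * (a + b) ≤ n
sum-square-≤ a b n a≤ b≤ = ≤-trans (*-mono-≤ a+b≤ a+b≤) (≤-trans (≤-reflexive (double (a ⊔ b))) (by-max (⊔-sel a b)))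
  where
  a+b≤ : a + b ≤ (a ⊔ b) + (a ⊔ b)
  a+b≤ = +-mono-≤ (m≤m⊔n a b) (m≤n⊔m a b)
  double : ∀ c → (c + c) * (c + c) ≡ 4 * (c * c)
  double = solve-∀
  by-max : a ⊔ b ≡ a ⊎ a ⊔ b ≡ b → 4 * ((a ⊔ b) * (a ⊔ b)) ≤ n
  by-max (inj₁ eq) = subst (λ c → 4 * (c * c) ≤ n) (sym eq) a≤
  by-max (inj₂ eq) = subst (λ c → 4 * (c * c) ≤ n) (sym eq) b≤

blocks-room : ∀ m h → 4 * ((144 * h) * (144 * h)) ≤ m → 4 * (49 * 49) ≤ m →
              ∃ λ u → 12 * h + 3 + u ≤ tri u × length (blocks (length (blocks u) + length (blocks u))) ≤ m
blocks-room m h big small with tri-bracket (12 * h + 3)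
... | u , _ , K+u≤ , tri≤ = u , K+u≤ , (begin
  length (blocks J)                  ≡⟨ length-blocks-closed J ⟩
  J * suc J                          ≤⟨ *-mono-≤ (≤-trans (n≤1+n J) J<) J< ⟩
  (144 * h + 49) * (144 * h + 49)    ≤⟨ sum-square-≤ (144 * h) 49 m big small ⟩
  m                                  ∎)
  where
  open ≤-Reasoning
  J : ℕ
  J = length (blocks u) + length (blocks u)
  J≡ : J ≡ 4 * tri u
  J≡ = trans (cong₂ _+_ (length-blocks u) (length-blocks u)) (quadruple (tri u))
    where
    quadruple : ∀ t → (t + t) + (t + t) ≡ 4 * t
    quadruple = solve-∀
  J< : suc J ≤ 144 * h + 49
  J< = subst (λ j → suc j ≤ 144 * h + 49) (sym J≡)
             (≤-trans (s≤s (*-monoʳ-≤ 4 tri≤)) (≤-reflexive (expand h)))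
    where
    expand : ∀ h → suc (4 * (3 * (12 * h + 3) + 3)) ≡ 144 * h + 49
    expand = solve-∀

S-periods-from-short-shifts : ∀ k m x y → length x ≡ m → length y ≡ m → 1 ≤ m →
                              (∀ p → 1 ≤ p → p < m → k < mismatches (S x y) p) →
                              (HAM x y + HAM x y ≡ k → IsSmallestKPeriod k (S x y) m)
                              × (k < HAM x y + HAM x y → ∀ p → IsKPeriod k (S x y) p → m < p)
S-periods-from-short-shifts k m x y |x| |y| 1≤m short = smallest , beyond
  where
  at-m : mismatches (S x y) m ≡ HAM x y + HAM x y
  at-m = subst (λ i → mismatches (S x y) i ≡ HAM x y + HAM x y) |x| (mismatches-S-self x y (trans |x| (sym |y|)))
  m<S : m < length (S x y)
  m<S = subst (m <_) (sym (trans (length-S x y) (cong₂ (λ a b → a + (b + (a + a))) |x| |y|)))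
              (subst (_≤ m + (m + (m + m))) (+-comm m 1) (+-monoʳ-≤ m (≤-trans 1≤m (m≤m+n m (m + m)))))
  no-shorter : ∀ q → IsKPeriod k (S x y) q → m ≤ q
  no-shorter q (1≤q , _ , q-ok) with q <? m
  ... | yes q<m = contradiction q-ok (<⇒≱ (short q 1≤q q<m))
  ... | no  q≮m = ≮⇒≥ q≮m
  smallest : HAM x y + HAM x y ≡ k → IsSmallestKPeriod k (S x y) m
  smallest eq = (1≤m , m<S , ≤-reflexive (trans at-m eq)) , no-shorter
  beyond : k < HAM x y + HAM x y → ∀ p → IsKPeriod k (S x y) p → m < p
  beyond k< p p-period@(_ , _ , p-ok) = ≤∧≢⇒< (no-shorter p p-period) m≢p
    where
    m≢p : m ≢ p
    m≢p refl = contradiction p-ok (<⇒≱ (subst (k <_) (sym at-m) k<))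

periods-of-S : ∀ m k → 2 ∣ k → 4 * (144 * 144) * (k * k) ≤ m * 4 → 4 * (49 * 49) ≤ m →
               ∀ x y → InX m k x → InY m k x y →
               ((HAM x y ≡ k / 2) → IsSmallestKPeriod k (S x y) m)
               × ((HAM x y ≡ k / 2 + 1) → ∀ p → IsKPeriod k (S x y) p → m < p)
periods-of-S m k 2∣k big small x y (|x| , x-ν) (|y| , x-y) =
    (λ eq → proj₁ periods (trans (cong₂ _+_ eq eq) (sym k≡h+h)))
  , (λ eq → proj₂ periods (subst (k <_) (cong₂ _+_ (sym eq) (sym eq)) k<h+1+h+1))
  where
  h : ℕ
  h = k / 2
  k≡h+h : k ≡ h + h
  k≡h+h = trans (sym (m/n*n≡m 2∣k)) (twice h)
    where
    twice : ∀ h → h * 2 ≡ h + h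
    twice = solve-∀
  big' : 4 * ((144 * h) * (144 * h)) ≤ m
  big' = *-cancelʳ-≤ (4 * ((144 * h) * (144 * h))) m 4
           (subst (_≤ m * 4) (rescale 144 h) (subst (λ κ → 4 * (144 * 144) * (κ * κ) ≤ m * 4) k≡h+h big))
    where
    -- The constant is abstracted: normalising 4 * (144 * 144) * … with the solver is very slow.
    rescale : ∀ a h → 4 * (a * a) * ((h + h) * (h + h)) ≡ 4 * ((a * h) * (a * h)) * 4
    rescale = solve-∀
  xy≤ : HAM x y ≤ h + 1
  xy≤ = [ (λ e → ≤-trans (≤-reflexive e) (m≤m+n h 1)) , ≤-reflexive ]′ x-y
  periods : (HAM x y + HAM x y ≡ k → IsSmallestKPeriod k (S x y) m)
            × (k < HAM x y + HAM x y → ∀ p → IsKPeriod k (S x y) p → m < p)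
  periods = S-periods-from-short-shifts k m x y |x| |y| (≤-trans (m≤m*n 1 (4 * (49 * 49))) small) short
    where
    short : ∀ p → 1 ≤ p → p < m → k < mismatches (S x y) p
    short p 1≤p p<m =
      let u , K+u≤ , room = blocks-room m h big' small
      in subst (_< mismatches (S x y) p) (sym k≡h+h) (short-shifts-S m h u x y K+u≤ room |x| |y| x-ν xy≤ p 1≤p p<m)
  k<h+1+h+1 : k < (h + 1) + (h + 1)
  k<h+1+h+1 = subst₂ _<_ (sym k≡h+h) (regroup h) (n≤1+n (suc (h + h)))
    where
    regroup : ∀ h → suc (suc (h + h)) ≡ (h + 1) + (h + 1)
    regroup = solve-∀

mainTheorem11 : (k : ℕ → ℕ) → LittleOSqrt k →
    ∃ λ N → ∀ n → N ≤ n → 4 ∣ n → 2 ∣ k n →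
      ∀ (x y : List Bool) → InX (n / 4) (k n) x → InY (n / 4) (k n) x y →
        ((HAM x y ≡ k n / 2) → IsSmallestKPeriod (k n) (S x y) (n / 4))
        × ((HAM x y ≡ k n / 2 + 1) → ∀ p → IsKPeriod (k n) (S x y) p → n / 4 < p)
mainTheorem11 k k-small with k-small (4 * (144 * 144))
... | N₀ , k²-small = N₀ + 4 * (49 * 49) * 4 , λ n N≤n 4∣n 2∣k →
  periods-of-S (n / 4) (k n) 2∣k
    (subst (4 * (144 * 144) * (k n * k n) ≤_) (sym (m/n*n≡m 4∣n)) (k²-small n (≤-trans (m≤m+n N₀ _) N≤n)))
    (*-cancelʳ-≤ (4 * (49 * 49)) (n / 4) 4
       (subst (4 * (49 * 49) * 4 ≤_) (sym (m/n*n≡m 4∣n)) (≤-trans (m≤n+m _ N₀) N≤n)))
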